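{- If $(P,\mathcal{L})$ is an $r$-uniform linear system with $\nu_2(P,\mathcal{L})-1\leq r$, then $$\lceil \nu_2(P,\mathcal{L})/2\rceil\leq \frac{|P|+|\mathcal{L}|}{r+1}.$$
   Context: A linear system is a pair $(P,\mathcal{L})$ where $P$ is a finite set (points) and $\mathcal{L}$ is a family of subsets of $P$ (lines) such that $|l\cap l'|\leq 1$ for all distinct $l,l'\in\mathcal{L}$; it is $r$-uniform if every line has exactly $r$ points. A 2-packing is a set $R\subseteq\mathcal{L}$ such that no three lines of $R$ have a common point; $\nu_2(P,\mathcal{L})$ is the maximum size of a 2-packing. -}

module Defs where

open import Data.Nat using (ℕ; _≤_)
open import Data.Fin using (Fin)
open import Data.Fin.Subset using (Subset; _∈_; _∩_; ∣_∣)
open import Data.Product using (_×_; Σ)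
open import Relation.Binary.PropositionalEquality using (_≡_; _≢_)
open import Relation.Nullary using (¬_)

-- A linear system with point set Fin n and m lines. Lines are indexed by
-- Fin m; the indexing is injective, so L is a genuine family (set) of m
-- distinct subsets of the points, and |𝓛| = m.
record LinearSystem (n m : ℕ) : Set where
  field
    line      : Fin m → Subset n
    injective : ∀ i j → line i ≡ line j → i ≡ j
    linear    : ∀ i j → i ≢ j → ∣ line i ∩ line j ∣ ≤ 1
open LinearSystem public

Uniform : ∀ {n m} → LinearSystem n m → ℕ → Set
Uniform S r = ∀ i → ∣ line S i ∣ ≡ r

IsTwoPacking : ∀ {n m} → LinearSystem n m → Subset m → Set
IsTwoPacking {n} S R =
  ∀ i j k → i ∈ R → j ∈ R → k ∈ R → i ≢ j → i ≢ k → j ≢ k →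
  ∀ (p : Fin n) → ¬ (p ∈ line S i × p ∈ line S j × p ∈ line S k)

IsNu2 : ∀ {n m} → LinearSystem n m → ℕ → Set
IsNu2 {m = m} S k =
  Σ (Subset m) (λ R → IsTwoPacking S R × ∣ R ∣ ≡ k)
  × (∀ R → IsTwoPacking S R → ∣ R ∣ ≤ k)

-- Any k lines of an r-uniform linear system cover at least k r − C(k,2) points,
-- since each new line meets the previous ones in at most one point apiece.
-- With k = ν₂ ≤ |𝓛| lines this gives |P| + |𝓛| ≥ k (r + 1) − C(k,2), and when
-- k − 1 ≤ r we have C(k,2) ≤ ⌊k/2⌋ k ≤ ⌊k/2⌋ (r + 1), leaving ⌈k/2⌉ (r + 1).
module Submission where

open import Defs
open import Data.Nat using (ℕ; zero; suc; z≤n; s≤s; _≤_; _+_; _*_; _∸_; _⊓_; ⌊_/2⌋; ⌈_/2⌉)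
open import Data.Nat.Properties
open import Data.Nat.Combinatorics using (_C_; nC1≡n; nCk+nC[k+1]≡[n+1]C[k+1])
open import Data.Fin using (Fin)
open import Data.Fin.Subset using (Subset; _∩_; _∪_; ∣_∣; ⋃; inside; outside)
open import Data.Fin.Subset.Properties using (∣p∣≤n; ∣⊥∣≡0; ∣p∩q∣≤∣q∣; ∩-distribˡ-∪)
open import Data.List using (List; []; _∷_; length; map; take; allFin)
open import Data.List.Properties using (length-map; length-take; length-tabulate)
open import Data.List.Relation.Unary.All using (All; []; _∷_; universal)
open import Data.List.Relation.Unary.All.Properties as All using ()
open import Data.List.Relation.Unary.AllPairs as AllPairs using (AllPairs; []; _∷_)
open import Data.List.Relation.Unary.AllPairs.Properties using (map⁺)
open import Data.List.Relation.Unary.Unique.Propositional using (Unique)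
open import Data.List.Relation.Unary.Unique.Propositional.Properties using (take⁺; allFin⁺)
open import Data.Vec using ([]; _∷_)
open import Data.Product using (_,_)
open import Relation.Binary.PropositionalEquality
open import Data.Nat.Tactic.RingSolver using (solve-∀)

∣p∣+∣q∣≡∣p∪q∣+∣p∩q∣ : ∀ {n} (p q : Subset n) → ∣ p ∣ + ∣ q ∣ ≡ ∣ p ∪ q ∣ + ∣ p ∩ q ∣
∣p∣+∣q∣≡∣p∪q∣+∣p∩q∣ []             []             = refl
∣p∣+∣q∣≡∣p∪q∣+∣p∩q∣ (outside ∷ p) (outside ∷ q) = ∣p∣+∣q∣≡∣p∪q∣+∣p∩q∣ p q
∣p∣+∣q∣≡∣p∪q∣+∣p∩q∣ (outside ∷ p) (inside ∷ q)  =
  trans (+-suc ∣ p ∣ ∣ q ∣) (cong suc (∣p∣+∣q∣≡∣p∪q∣+∣p∩q∣ p q))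
∣p∣+∣q∣≡∣p∪q∣+∣p∩q∣ (inside ∷ p)  (outside ∷ q) = cong suc (∣p∣+∣q∣≡∣p∪q∣+∣p∩q∣ p q)
∣p∣+∣q∣≡∣p∪q∣+∣p∩q∣ (inside ∷ p)  (inside ∷ q)  = cong suc (begin
  ∣ p ∣ + suc ∣ q ∣           ≡⟨ +-suc ∣ p ∣ ∣ q ∣ ⟩
  suc (∣ p ∣ + ∣ q ∣)         ≡⟨ cong suc (∣p∣+∣q∣≡∣p∪q∣+∣p∩q∣ p q) ⟩
  suc (∣ p ∪ q ∣ + ∣ p ∩ q ∣) ≡⟨ +-suc ∣ p ∪ q ∣ ∣ p ∩ q ∣ ⟨
  ∣ p ∪ q ∣ + suc ∣ p ∩ q ∣   ∎)
  where open ≡-Reasoning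

∣p∪q∣≤∣p∣+∣q∣ : ∀ {n} (p q : Subset n) → ∣ p ∪ q ∣ ≤ ∣ p ∣ + ∣ q ∣
∣p∪q∣≤∣p∣+∣q∣ p q = subst (∣ p ∪ q ∣ ≤_) (sym (∣p∣+∣q∣≡∣p∪q∣+∣p∩q∣ p q)) (m≤m+n _ _)

∣p∩⋃qs∣≤length : ∀ {n} (p : Subset n) (qs : List (Subset n)) →
  All (λ q → ∣ p ∩ q ∣ ≤ 1) qs → ∣ p ∩ ⋃ qs ∣ ≤ length qs
∣p∩⋃qs∣≤length {n} p []       []           = subst (∣ p ∩ ⋃ [] ∣ ≤_) (∣⊥∣≡0 n) (∣p∩q∣≤∣q∣ p (⋃ []))
∣p∩⋃qs∣≤length     p (q ∷ qs) (pq≤1 ∷ pqs≤1) = begin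
  ∣ p ∩ (q ∪ ⋃ qs) ∣           ≡⟨ cong ∣_∣ (∩-distribˡ-∪ p q (⋃ qs)) ⟩
  ∣ (p ∩ q) ∪ (p ∩ ⋃ qs) ∣     ≤⟨ ∣p∪q∣≤∣p∣+∣q∣ (p ∩ q) (p ∩ ⋃ qs) ⟩
  ∣ p ∩ q ∣ + ∣ p ∩ ⋃ qs ∣     ≤⟨ +-mono-≤ pq≤1 (∣p∩⋃qs∣≤length p qs pqs≤1) ⟩
  suc (length qs)               ∎
  where open ≤-Reasoning

[1+n]C2≡n+nC2 : ∀ n → suc n C 2 ≡ n + n C 2
[1+n]C2≡n+nC2 n = trans (sym (nCk+nC[k+1]≡[n+1]C[k+1] n 1)) (cong (_+ n C 2) (nC1≡n n))

length*r≤∣⋃∣+C2 : ∀ {n} r (qs : List (Subset n)) →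
  All (λ q → ∣ q ∣ ≡ r) qs → AllPairs (λ p q → ∣ p ∩ q ∣ ≤ 1) qs →
  length qs * r ≤ ∣ ⋃ qs ∣ + length qs C 2
length*r≤∣⋃∣+C2 r []       []           []          = z≤n
length*r≤∣⋃∣+C2 r (q ∷ qs) (∣q∣≡r ∷ sizes) (meets ∷ pairs) = begin
  r + k * r                        ≤⟨ +-monoʳ-≤ r (length*r≤∣⋃∣+C2 r qs sizes pairs) ⟩
  r + (∣ U ∣ + k C 2)              ≡⟨ +-assoc r ∣ U ∣ (k C 2) ⟨
  (r + ∣ U ∣) + k C 2              ≡⟨ cong (λ s → (s + ∣ U ∣) + k C 2) ∣q∣≡r ⟨
  (∣ q ∣ + ∣ U ∣) + k C 2          ≡⟨ cong (_+ k C 2) (∣p∣+∣q∣≡∣p∪q∣+∣p∩q∣ q U) ⟩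
  (∣ q ∪ U ∣ + ∣ q ∩ U ∣) + k C 2  ≤⟨ +-monoˡ-≤ (k C 2) (+-monoʳ-≤ ∣ q ∪ U ∣ (∣p∩⋃qs∣≤length q qs meets)) ⟩
  (∣ q ∪ U ∣ + k) + k C 2          ≡⟨ +-assoc ∣ q ∪ U ∣ k (k C 2) ⟩
  ∣ q ∪ U ∣ + (k + k C 2)          ≡⟨ cong (∣ q ∪ U ∣ +_) ([1+n]C2≡n+nC2 k) ⟨
  ∣ q ∪ U ∣ + suc k C 2            ∎
  where
  open ≤-Reasoning
  k = length qs
  U = ⋃ qs

n≤1+2⌊n/2⌋ : ∀ n → n ≤ suc (2 * ⌊ n /2⌋)
n≤1+2⌊n/2⌋ zero          = z≤n
n≤1+2⌊n/2⌋ (suc zero)    = s≤s z≤n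
n≤1+2⌊n/2⌋ (suc (suc n)) =
  s≤s (s≤s (≤-trans (n≤1+2⌊n/2⌋ n) (≤-reflexive (sym (+-suc ⌊ n /2⌋ (⌊ n /2⌋ + 0))))))

nC2≤⌊n/2⌋*n : ∀ n → n C 2 ≤ ⌊ n /2⌋ * n
nC2≤⌊n/2⌋*n zero          = z≤n
nC2≤⌊n/2⌋*n (suc zero)    = z≤n
nC2≤⌊n/2⌋*n (suc (suc n)) = begin
  suc (suc n) C 2                ≡⟨ [1+n]C2≡n+nC2 (suc n) ⟩
  suc n + suc n C 2              ≡⟨ cong (suc n +_) ([1+n]C2≡n+nC2 n) ⟩
  suc n + (n + n C 2)            ≤⟨ +-monoʳ-≤ (suc n) (+-mono-≤ (n≤1+2⌊n/2⌋ n) (nC2≤⌊n/2⌋*n n)) ⟩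
  suc n + (suc (2 * h) + h * n)  ≡⟨ regroup n h ⟩
  suc h * suc (suc n)            ∎
  where
  open ≤-Reasoning
  h = ⌊ n /2⌋
  regroup : ∀ n h → suc n + (suc (2 * h) + h * n) ≡ suc h * suc (suc n)
  regroup = solve-∀

⌈k/2⌉*[1+r]+kC2≤k*[1+r] : ∀ k r → k ∸ 1 ≤ r → ⌈ k /2⌉ * suc r + k C 2 ≤ k * suc r
⌈k/2⌉*[1+r]+kC2≤k*[1+r] k r k∸1≤r = begin
  ⌈ k /2⌉ * suc r + k C 2          ≤⟨ +-monoʳ-≤ (⌈ k /2⌉ * suc r) (≤-trans (nC2≤⌊n/2⌋*n k) (*-monoʳ-≤ ⌊ k /2⌋ k≤1+r)) ⟩
  ⌈ k /2⌉ * suc r + ⌊ k /2⌋ * suc r ≡⟨ *-distribʳ-+ (suc r) ⌈ k /2⌉ ⌊ k /2⌋ ⟨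
  (⌈ k /2⌉ + ⌊ k /2⌋) * suc r       ≡⟨ cong (_* suc r) (trans (+-comm ⌈ k /2⌉ ⌊ k /2⌋) (⌊n/2⌋+⌈n/2⌉≡n k)) ⟩
  k * suc r                         ∎
  where
  open ≤-Reasoning
  k≤1+r : k ≤ suc r
  k≤1+r = ≤-trans (m≤n+m∸n k 1) (s≤s k∸1≤r)

module _ {n m} (S : LinearSystem n m) {r} (uniform : Uniform S r) where

  distinct-lines-cover : ∀ (is : List (Fin m)) → Unique is →
    length is * r ≤ n + length is C 2
  distinct-lines-cover is distinct = begin
    length is * r                          ≡⟨ cong (_* r) (length-map (line S) is) ⟨
    length ls * r                          ≤⟨ length*r≤∣⋃∣+C2 r ls sizes pairs ⟩
    ∣ ⋃ ls ∣ + length ls C 2               ≤⟨ +-monoˡ-≤ _ (∣p∣≤n (⋃ ls)) ⟩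
    n + length ls C 2                      ≡⟨ cong (λ k → n + k C 2) (length-map (line S) is) ⟩
    n + length is C 2                      ∎
    where
    open ≤-Reasoning
    ls = map (line S) is
    sizes : All (λ q → ∣ q ∣ ≡ r) ls
    sizes = All.map⁺ (universal uniform is)
    pairs : AllPairs (λ p q → ∣ p ∩ q ∣ ≤ 1) ls
    pairs = map⁺ (AllPairs.map (λ {i} {j} → linear S i j) distinct)

  k*r≤n+kC2 : ∀ k → k ≤ m → k * r ≤ n + k C 2
  k*r≤n+kC2 k k≤m = subst (λ l → l * r ≤ n + l C 2) length-first
    (distinct-lines-cover (take k (allFin m)) (take⁺ k (allFin⁺ m)))
    where
    length-first : length (take k (allFin m)) ≡ k
    length-first = trans (length-take k (allFin m))
      (trans (cong (k ⊓_) (length-tabulate (λ i → i))) (m≤n⇒m⊓n≡m k≤m))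

theorem2p5 : ∀ (n m r : ℕ) (S : LinearSystem n m) → Uniform S r →
    ∀ (ν : ℕ) → IsNu2 S ν → ν ∸ 1 ≤ r →
    ⌈ ν /2⌉ * suc r ≤ n + m
theorem2p5 n m r S uniform ν ((R , _ , ∣R∣≡ν) , _) ν∸1≤r =
  +-cancelʳ-≤ (ν C 2) _ _ (begin
    ⌈ ν /2⌉ * suc r + ν C 2  ≤⟨ ⌈k/2⌉*[1+r]+kC2≤k*[1+r] ν r ν∸1≤r ⟩
    ν * suc r                ≡⟨ *-suc ν r ⟩
    ν + ν * r                ≤⟨ +-mono-≤ ν≤m (k*r≤n+kC2 S uniform ν ν≤m) ⟩
    m + (n + ν C 2)          ≡⟨ +-assoc m n (ν C 2) ⟨
    m + n + ν C 2            ≡⟨ cong (_+ ν C 2) (+-comm m n) ⟩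
    n + m + ν C 2            ∎)
  where
  open ≤-Reasoning
  ν≤m : ν ≤ m
  ν≤m = subst (_≤ m) ∣R∣≡ν (∣p∣≤n R)
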